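{- Let $T$ be a tournament on $4$ or more vertices with a vertex $x$ of out-degree $1$, and let $y$ be the vertex with $x\rightarrow y$. Then $T$ is quadrangular if and only if all of the following hold: (1) $O(y)=V(T)\setminus\{x,y\}$; (2) $\gamma(T-\{x,y\})>2$; (3) $\gamma((T-\{x,y\})^{r})>2$; (4) $\delta^{+}(T-\{x,y\})\geq 2$; (5) $\delta^{ - }(T-\{x,y\})\geq 2$.
   Context: A tournament $T$ is a loopless digraph in which for each pair of distinct vertices exactly one of $(u,v)$, $(v,u)$ is an arc; $u\rightarrow v$ means $(u,v)$ is an arc. $O(v)=\{u:v\rightarrow u\}$, $I(v)=\{u:u\rightarrow v\}$. A digraph is quadrangular if for all distinct $u,v$, $|O(u)\cap O(v)|\neq 1$ and $|I(u)\cap I(v)|\neq 1$. $T-\{x,y\}$ is the subtournament induced on $V(T)\setminus\{x,y\}$. The dual $T^{r}$ has the same vertices with $a\rightarrow b$ in $T^r$ iff $b\rightarrow a$ in $T$. $\delta^{+}$, $\delta^{ - }$ denote minimum out-degree and minimum in-degree. A dominating set of a digraph $D$ is a set $S$ of vertices such that every vertex is in $S$ or dominated by some vertex of $S$; $\gamma(D)$ is the minimum size of a dominating set. -}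

module Defs where

open import Data.Nat using (ℕ; _≤_; _<_)
open import Data.Bool using (Bool; true; false)
open import Data.Fin using (Fin)
open import Data.Fin.Subset using (Subset; _∈_; _⊆_; ∣_∣; _∩_; ⁅_⁆; _∪_; ∁)
open import Data.Vec using (tabulate)
open import Data.Product using (_×_; ∃-syntax)
open import Data.Sum using (_⊎_)
open import Relation.Binary.PropositionalEquality using (_≡_; _≢_)
open import Relation.Nullary using (¬_)

-- A digraph on vertex set Fin n, given by its (decidable) arc relation:
-- arc u v ≡ true  means  u → v.
Digraph : ℕ → Set
Digraph n = Fin n → Fin n → Bool

record IsTournament {n : ℕ} (D : Digraph n) : Set where
  field
    loopless : ∀ v → D v v ≡ false
    total    : ∀ u v → u ≢ v → D u v ≡ true ⊎ D v u ≡ true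
    antisym  : ∀ u v → D u v ≡ true → D v u ≡ false

O : ∀ {n} → Digraph n → Fin n → Subset n
O D v = tabulate (λ u → D v u)

I : ∀ {n} → Digraph n → Fin n → Subset n
I D v = tabulate (λ u → D u v)

Quadrangular : ∀ {n} → Digraph n → Set
Quadrangular {n} D = ∀ (u v : Fin n) → u ≢ v →
  (∣ O D u ∩ O D v ∣ ≢ 1) × (∣ I D u ∩ I D v ∣ ≢ 1)

rev : ∀ {n} → Digraph n → Digraph n
rev D a b = D b a

-- Induced subdigraphs are represented by a vertex subset S of the host digraph D;
-- all notions below refer to the subdigraph D[S] induced on S.

IsDominatingSet : ∀ {n} → Digraph n → Subset n → Subset n → Set
IsDominatingSet {n} D S Dom =
  Dom ⊆ S × (∀ (v : Fin n) → v ∈ S → v ∈ Dom ⊎ ∃[ d ] (d ∈ Dom × D d v ≡ true))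

DominationNumber> : ∀ {n} → Digraph n → Subset n → ℕ → Set
DominationNumber> D S k = ∀ Dom → IsDominatingSet D S Dom → k < ∣ Dom ∣

MinOutDeg≥ : ∀ {n} → Digraph n → Subset n → ℕ → Set
MinOutDeg≥ {n} D S k = ∀ (v : Fin n) → v ∈ S → k ≤ ∣ O D v ∩ S ∣

MinInDeg≥ : ∀ {n} → Digraph n → Subset n → ℕ → Set
MinInDeg≥ {n} D S k = ∀ (v : Fin n) → v ∈ S → k ≤ ∣ I D v ∩ S ∣

without : ∀ {n} → Fin n → Fin n → Subset n
without x y = ∁ (⁅ x ⁆ ∪ ⁅ y ⁆)

{-# OPTIONS --safe #-}
-- Write S = V ∖ {x, y}. Since y is the only out-neighbour of x, every v ∈ S has v → x, and if T
-- is quadrangular then also y → v (otherwise O(x) ∩ O(v) = {y}). So (p, q) = (x, y) is a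
-- "pendant arc": q is the only out-neighbour of p and q → v → p for all v ∈ S, a configuration
-- that is preserved by reversing all arcs and swapping p and q. For a pendant arc the condition
-- |O(u) ∩ O(v)| ≠ 1 can be checked pair by pair: the intersection is empty when p ∈ {u, v}, it is
-- O(v) ∩ S when u = q, and for u, v ∈ S it contains p, so it is ≠ 1 exactly when u and v have a
-- common out-neighbour in S. In a tournament, γ(T[S]) > 2 says precisely that any two vertices of
-- S have a common in-neighbour in S. Applying all this to T and to its dual gives the theorem.
module Submission where

open import Defs
open import Data.Bool using (true)
open import Data.Bool.Properties using () renaming (_≟_ to _≟ᵇ_)
open import Data.Empty using (⊥)
open import Data.Fin using (Fin; _≟_)
open import Data.Fin.Properties using (any?)
open import Data.Fin.Subset using (Subset; inside; outside; ∣_∣; _∈_; _∩_; _∪_; ⁅_⁆; ∁; _⊆_; Nonempty; Empty)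
open import Data.Fin.Subset.Properties
  using (_∈?_; Empty-unique; ∣⊥∣≡0; ∣⁅x⁆∣≡1; ∣p∣≤∣x∷p∣; ∣∁p∣≡n∸∣p∣; p⊆q⇒∣p∣≤∣q∣;
         x∈p⇒∣p-x∣<∣p∣; x∈p∧x≢y⇒x∈p-y; x∈⁅x⁆; x∈⁅y⁆⇒x≡y; x∈p∩q⁺; x∈p∩q⁻; x∈p∪q⁺; x∈p∪q⁻;
         x∉p⇒x∈∁p; x∈∁p⇒x∉p; ∩-comm; ∪-comm; ⊆-antisym)
open import Data.Nat using (ℕ; _≤_; _<_; _+_; _∸_; z≤n; s≤s)
open import Data.Nat.Properties
  using (≤-trans; ≤-reflexive; ≤∧≢⇒<; <⇒≱; >⇒≢; 0≢1+n; +-suc; +-monoʳ-≤; ∸-monoˡ-≤; ∸-monoʳ-≤)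
open import Data.Product using (_×_; _,_; proj₁; proj₂; ∃-syntax)
open import Data.Product.Function.NonDependent.Propositional using (_×-⇔_)
open import Data.Sum using (_⊎_; inj₁; inj₂; [_,_]′)
open import Data.Vec using (_∷_; [])
open import Data.Vec.Properties using (lookup∘tabulate; []=⇒lookup; lookup⇒[]=)
open import Function using (_∘_)
open import Function.Bundles using (_⇔_; mk⇔; Equivalence)
open import Function.Properties.Equivalence using () renaming (trans to ⇔-trans)
open import Relation.Binary.PropositionalEquality using (_≡_; _≢_; refl; sym; trans; cong; cong₂; subst; ≢-sym)
open import Relation.Nullary using (¬_; yes; no; contradiction; ¬?)
open import Relation.Nullary.Decidable using (_×-dec_)

private variable
  n : ℕ
  p : Subset n
  a b c u v w x y z : Fin n
  D : Digraph n

x∈p⇒0<∣p∣ : x ∈ p → 0 < ∣ p ∣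
x∈p⇒0<∣p∣ x∈p = ≤-trans (s≤s z≤n) (x∈p⇒∣p-x∣<∣p∣ x∈p)

x∈p∧y∈p∧x≢y⇒1<∣p∣ : x ∈ p → y ∈ p → x ≢ y → 1 < ∣ p ∣
x∈p∧y∈p∧x≢y⇒1<∣p∣ x∈p y∈p x≢y =
  ≤-trans (s≤s (x∈p⇒0<∣p∣ (x∈p∧x≢y⇒x∈p-y x∈p x≢y))) (x∈p⇒∣p-x∣<∣p∣ y∈p)

x∈p∧y∈p∧z∈p∧distinct⇒2<∣p∣ : x ∈ p → y ∈ p → z ∈ p → x ≢ y → x ≢ z → y ≢ z → 2 < ∣ p ∣
x∈p∧y∈p∧z∈p∧distinct⇒2<∣p∣ x∈p y∈p z∈p x≢y x≢z y≢z =
  ≤-trans (s≤s (x∈p∧y∈p∧x≢y⇒1<∣p∣ (x∈p∧x≢y⇒x∈p-y x∈p x≢z) (x∈p∧x≢y⇒x∈p-y y∈p y≢z) x≢y))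
          (x∈p⇒∣p-x∣<∣p∣ z∈p)

∣p∣≢1∧x∈p⇒1<∣p∣ : ∣ p ∣ ≢ 1 → x ∈ p → 1 < ∣ p ∣
∣p∣≢1∧x∈p⇒1<∣p∣ ∣p∣≢1 x∈p = ≤∧≢⇒< (x∈p⇒0<∣p∣ x∈p) (≢-sym ∣p∣≢1)

Empty⇒∣p∣≢1 : Empty p → ∣ p ∣ ≢ 1
Empty⇒∣p∣≢1 {n} empty ∣p∣≡1 =
  0≢1+n (trans (sym (∣⊥∣≡0 n)) (trans (cong ∣_∣ (sym (Empty-unique empty))) ∣p∣≡1))

1<∣p∣⇒∃≢ : 1 < ∣ p ∣ → ∀ x → ∃[ y ] (y ∈ p × y ≢ x)
1<∣p∣⇒∃≢ {p = p} 1<∣p∣ x with any? (λ y → (y ∈? p) ×-dec ¬? (y ≟ x))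
... | yes other = other
... | no ∄other = contradiction (≤-trans (p⊆q⇒∣p∣≤∣q∣ p⊆⁅x⁆) (≤-reflexive (∣⁅x⁆∣≡1 x))) (<⇒≱ 1<∣p∣)
  where
  p⊆⁅x⁆ : p ⊆ ⁅ x ⁆
  p⊆⁅x⁆ {y} y∈p with y ≟ x
  ... | yes refl = x∈⁅x⁆ x
  ... | no y≢x = contradiction (y , y∈p , y≢x) ∄other

∣p∣≢1∧x∈p⇒∃≢x : ∣ p ∣ ≢ 1 → x ∈ p → ∃[ y ] (y ∈ p × y ≢ x)
∣p∣≢1∧x∈p⇒∃≢x {x = x} ∣p∣≢1 x∈p = 1<∣p∣⇒∃≢ (∣p∣≢1∧x∈p⇒1<∣p∣ ∣p∣≢1 x∈p) x

∣p∪q∣≤∣p∣+∣q∣ : ∀ (p q : Subset n) → ∣ p ∪ q ∣ ≤ ∣ p ∣ + ∣ q ∣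
∣p∪q∣≤∣p∣+∣q∣ []            []            = z≤n
∣p∪q∣≤∣p∣+∣q∣ (inside  ∷ p) (s ∷ q)       =
  s≤s (≤-trans (∣p∪q∣≤∣p∣+∣q∣ p q) (+-monoʳ-≤ ∣ p ∣ (∣p∣≤∣x∷p∣ s q)))
∣p∪q∣≤∣p∣+∣q∣ (outside ∷ p) (inside  ∷ q) =
  ≤-trans (s≤s (∣p∪q∣≤∣p∣+∣q∣ p q)) (≤-reflexive (sym (+-suc ∣ p ∣ ∣ q ∣)))
∣p∪q∣≤∣p∣+∣q∣ (outside ∷ p) (outside ∷ q) = ∣p∪q∣≤∣p∣+∣q∣ p q

∣⁅x⁆∪⁅y⁆∣≤2 : ∀ (x y : Fin n) → ∣ ⁅ x ⁆ ∪ ⁅ y ⁆ ∣ ≤ 2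
∣⁅x⁆∪⁅y⁆∣≤2 x y = ≤-trans (∣p∪q∣≤∣p∣+∣q∣ ⁅ x ⁆ ⁅ y ⁆) (≤-reflexive (cong₂ _+_ (∣⁅x⁆∣≡1 x) (∣⁅x⁆∣≡1 y)))

x∈⁅y⁆∪⁅z⁆⇒x≡y⊎x≡z : x ∈ ⁅ y ⁆ ∪ ⁅ z ⁆ → x ≡ y ⊎ x ≡ z
x∈⁅y⁆∪⁅z⁆⇒x≡y⊎x≡z {y = y} {z} x∈ with x∈p∪q⁻ ⁅ y ⁆ ⁅ z ⁆ x∈
... | inj₁ x∈⁅y⁆ = inj₁ (x∈⁅y⁆⇒x≡y y x∈⁅y⁆)
... | inj₂ x∈⁅z⁆ = inj₂ (x∈⁅y⁆⇒x≡y z x∈⁅z⁆)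

x∈without⁺ : z ≢ x → z ≢ y → z ∈ without x y
x∈without⁺ z≢x z≢y = x∉p⇒x∈∁p ([ z≢x , z≢y ]′ ∘ x∈⁅y⁆∪⁅z⁆⇒x≡y⊎x≡z)

x∈without⁻ : z ∈ without x y → z ≢ x × z ≢ y
x∈without⁻ {x = x} {y} z∈ =
  (λ { refl → x∈∁p⇒x∉p z∈ (x∈p∪q⁺ (inj₁ (x∈⁅x⁆ x))) }) ,
  (λ { refl → x∈∁p⇒x∉p z∈ (x∈p∪q⁺ {p = ⁅ x ⁆} (inj₂ (x∈⁅x⁆ y))) })

without-comm : ∀ (x y : Fin n) → without x y ≡ without y x
without-comm x y = cong ∁ (∪-comm ⁅ x ⁆ ⁅ y ⁆)

n∸2≤∣without∣ : ∀ (x y : Fin n) → n ∸ 2 ≤ ∣ without x y ∣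
n∸2≤∣without∣ {n} x y =
  ≤-trans (∸-monoʳ-≤ n (∣⁅x⁆∪⁅y⁆∣≤2 x y)) (≤-reflexive (sym (∣∁p∣≡n∸∣p∣ (⁅ x ⁆ ∪ ⁅ y ⁆))))

vertex-cases : ∀ (x y z : Fin n) → z ≡ x ⊎ z ≡ y ⊎ z ∈ without x y
vertex-cases x y z with z ≟ x | z ≟ y
... | yes z≡x | _       = inj₁ z≡x
... | no _    | yes z≡y = inj₂ (inj₁ z≡y)
... | no z≢x  | no z≢y  = inj₂ (inj₂ (x∈without⁺ z≢x z≢y))

arc⇒∈O : ∀ (D : Digraph n) {v z} → D v z ≡ true → z ∈ O D v
arc⇒∈O D {v} {z} vz = lookup⇒[]= z _ (trans (lookup∘tabulate (D v) z) vz)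

∈O⇒arc : ∀ (D : Digraph n) {v z} → z ∈ O D v → D v z ≡ true
∈O⇒arc D {v} {z} z∈ = trans (sym (lookup∘tabulate (D v) z)) ([]=⇒lookup z∈)

rev-isTournament : IsTournament D → IsTournament (rev D)
rev-isTournament tour = record
  { loopless = loopless
  ; total    = λ u v u≢v → total v u (≢-sym u≢v)
  ; antisym  = λ u v → antisym v u
  }
  where open IsTournament tour

module Tournament {D : Digraph n} (tour : IsTournament D) where
  open IsTournament tour

  irreflexive : D v v ≡ true → ⊥
  irreflexive {v} vv = contradiction (trans (sym vv) (loopless v)) λ ()

  asymmetric : D u v ≡ true → D v u ≡ true → ⊥
  asymmetric {u} {v} uv vu = contradiction (trans (sym vu) (antisym u v uv)) λ ()

  arc≢ : D u v ≡ true → u ≢ v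
  arc≢ uv refl = irreflexive uv

  ¬arc⇒arc : u ≢ v → ¬ D u v ≡ true → D v u ≡ true
  ¬arc⇒arc {u} {v} u≢v ¬uv with total u v u≢v
  ... | inj₁ uv = contradiction uv ¬uv
  ... | inj₂ vu = vu

CommonInNeighbours : Digraph n → Subset n → Set
CommonInNeighbours D S = ∀ {a b} → a ∈ S → b ∈ S → ∃[ w ] (w ∈ S × D w a ≡ true × D w b ≡ true)

module Domination {D : Digraph n} (tour : IsTournament D) {S : Subset n} where
  open Tournament tour

  dominator : ∀ {Dom} → IsDominatingSet D S Dom → v ∈ S → ∃[ d ] (d ∈ Dom × (d ≡ v ⊎ D d v ≡ true))
  dominator (_ , dominates) v∈S with dominates _ v∈S
  ... | inj₁ v∈Dom             = _ , v∈Dom , inj₁ refl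
  ... | inj₂ (d , d∈Dom , d→v) = d , d∈Dom , inj₂ d→v

  dominator-of-in-neighbour : D w a ≡ true → c ≡ w ⊎ D c w ≡ true → c ≢ a
  dominator-of-in-neighbour w→a (inj₁ refl) refl = irreflexive w→a
  dominator-of-in-neighbour w→a (inj₂ c→w) refl = asymmetric w→a c→w

  -- A dominator of a common in-neighbour of a and b is neither a nor b: starting from any
  -- a ∈ Dom this produces b ∈ Dom, and then a third member c.
  commonInNeighbours⇒γ>2 : Nonempty S → CommonInNeighbours D S → DominationNumber> D S 2
  commonInNeighbours⇒γ>2 (v , v∈S) common Dom isDom@(Dom⊆S , _) =
    let a , a∈Dom , _       = dominator isDom v∈S
        w₁ , w₁∈S , w₁→a , _ = common (Dom⊆S a∈Dom) (Dom⊆S a∈Dom)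
        b , b∈Dom , b↠w₁    = dominator isDom w₁∈S
        w₂ , w₂∈S , w₂→a , w₂→b = common (Dom⊆S a∈Dom) (Dom⊆S b∈Dom)
        c , c∈Dom , c↠w₂    = dominator isDom w₂∈S
    in x∈p∧y∈p∧z∈p∧distinct⇒2<∣p∣ a∈Dom b∈Dom c∈Dom
         (≢-sym (dominator-of-in-neighbour w₁→a b↠w₁))
         (≢-sym (dominator-of-in-neighbour w₂→a c↠w₂))
         (≢-sym (dominator-of-in-neighbour w₂→b c↠w₂))

  pair-dominates : a ∈ S → b ∈ S → ¬ (∃[ w ] (w ∈ S × D w a ≡ true × D w b ≡ true)) →
                   IsDominatingSet D S (⁅ a ⁆ ∪ ⁅ b ⁆)
  pair-dominates {a} {b} a∈S b∈S ∄common = pair⊆S , dominates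
    where
    pair⊆S : ⁅ a ⁆ ∪ ⁅ b ⁆ ⊆ S
    pair⊆S z∈ with x∈⁅y⁆∪⁅z⁆⇒x≡y⊎x≡z z∈
    ... | inj₁ refl = a∈S
    ... | inj₂ refl = b∈S
    a∈pair : a ∈ ⁅ a ⁆ ∪ ⁅ b ⁆
    a∈pair = x∈p∪q⁺ (inj₁ (x∈⁅x⁆ a))
    b∈pair : b ∈ ⁅ a ⁆ ∪ ⁅ b ⁆
    b∈pair = x∈p∪q⁺ {p = ⁅ a ⁆} (inj₂ (x∈⁅x⁆ b))
    dominates : ∀ w → w ∈ S → w ∈ ⁅ a ⁆ ∪ ⁅ b ⁆ ⊎ ∃[ d ] (d ∈ ⁅ a ⁆ ∪ ⁅ b ⁆ × D d w ≡ true)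
    dominates w w∈S with w ≟ a | w ≟ b
    ... | yes refl | _        = inj₁ a∈pair
    ... | no _     | yes refl = inj₁ b∈pair
    ... | no w≢a   | no w≢b with D w a ≟ᵇ true | D w b ≟ᵇ true
    ...   | yes w→a | yes w→b = contradiction (w , w∈S , w→a , w→b) ∄common
    ...   | no ¬w→a | _       = inj₂ (a , a∈pair , ¬arc⇒arc w≢a ¬w→a)
    ...   | yes _   | no ¬w→b = inj₂ (b , b∈pair , ¬arc⇒arc w≢b ¬w→b)

  γ>2⇒commonInNeighbours : DominationNumber> D S 2 → CommonInNeighbours D S
  γ>2⇒commonInNeighbours γ>2 {a} {b} a∈S b∈S
    with any? (λ w → (w ∈? S) ×-dec (D w a ≟ᵇ true) ×-dec (D w b ≟ᵇ true))
  ... | yes common = common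
  ... | no ∄common =
    contradiction (γ>2 _ (pair-dominates a∈S b∈S ∄common)) (<⇒≱ (s≤s (∣⁅x⁆∪⁅y⁆∣≤2 a b)))

OutQuadrangular : Digraph n → Set
OutQuadrangular {n} D = ∀ (u v : Fin n) → u ≢ v → ∣ O D u ∩ O D v ∣ ≢ 1

-- The in-neighbourhood I D v is definitionally O (rev D) v, and MinInDeg≥ D is MinOutDeg≥ (rev D).
quadrangular⇔ : Quadrangular D ⇔ (OutQuadrangular D × OutQuadrangular (rev D))
quadrangular⇔ = mk⇔
  (λ Q → (λ u v u≢v → proj₁ (Q u v u≢v)) , (λ u v u≢v → proj₂ (Q u v u≢v)))
  (λ (Q⁺ , Q⁻) u v u≢v → Q⁺ u v u≢v , Q⁻ u v u≢v)

symmetric-by-cases : (R : Fin n → Fin n → Set) → (∀ {u v} → R u v → R v u) →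
  R x y → (∀ {v} → v ∈ without x y → R x v) → (∀ {v} → v ∈ without x y → R y v) →
  (∀ {u v} → u ∈ without x y → v ∈ without x y → R u v) →
  ∀ u v → u ≢ v → R u v
symmetric-by-cases {x = x} {y} R R-sym Rxy Rx Ry RS u v u≢v with vertex-cases x y u | vertex-cases x y v
... | inj₁ refl        | inj₁ refl        = contradiction refl u≢v
... | inj₁ refl        | inj₂ (inj₁ refl) = Rxy
... | inj₁ refl        | inj₂ (inj₂ v∈S)  = Rx v∈S
... | inj₂ (inj₁ refl) | inj₁ refl        = R-sym Rxy
... | inj₂ (inj₁ refl) | inj₂ (inj₁ refl) = contradiction refl u≢v
... | inj₂ (inj₁ refl) | inj₂ (inj₂ v∈S)  = Ry v∈S
... | inj₂ (inj₂ u∈S)  | inj₁ refl        = R-sym (Rx u∈S)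
... | inj₂ (inj₂ u∈S)  | inj₂ (inj₁ refl) = R-sym (Ry u∈S)
... | inj₂ (inj₂ u∈S)  | inj₂ (inj₂ v∈S)  = RS u∈S v∈S

record PendantArc (D : Digraph n) (p q : Fin n) : Set where
  field
    p→q     : D p q ≡ true
    p→z⇒z≡q : ∀ {z} → D p z ≡ true → z ≡ q
    q→S     : ∀ {v} → v ∈ without p q → D q v ≡ true
    S→p     : ∀ {v} → v ∈ without p q → D v p ≡ true

PendantArc-rev : ∀ {p q} → IsTournament D → PendantArc D p q → PendantArc (rev D) q p
PendantArc-rev {D = D} {p} {q} tour P = record
  { p→q     = p→q
  ; p→z⇒z≡q = z→q⇒z≡p
  ; q→S     = S→p ∘ subst (_ ∈_) (without-comm q p)
  ; S→p     = q→S ∘ subst (_ ∈_) (without-comm q p)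
  }
  where
  open PendantArc P
  open Tournament tour
  z→q⇒z≡p : D z q ≡ true → z ≡ p
  z→q⇒z≡p {z} z→q with z ≟ p
  ... | yes z≡p = z≡p
  ... | no z≢p  = contradiction (q→S (x∈without⁺ z≢p (arc≢ z→q))) (asymmetric z→q)

module PendantArcProperties {D : Digraph n} (tour : IsTournament D)
                            {p q : Fin n} (P : PendantArc D p q) where
  open Tournament tour
  open PendantArc P

  S : Subset n
  S = without p q

  O-q≡S : O D q ≡ S
  O-q≡S = ⊆-antisym O-q⊆S (arc⇒∈O D ∘ q→S)
    where
    O-q⊆S : O D q ⊆ S
    O-q⊆S z∈ = x∈without⁺ (λ { refl → asymmetric p→q (∈O⇒arc D z∈) }) (≢-sym (arc≢ (∈O⇒arc D z∈)))

  ∣O-q∩O-v∣≡∣O-v∩S∣ : ∣ O D q ∩ O D v ∣ ≡ ∣ O D v ∩ S ∣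
  ∣O-q∩O-v∣≡∣O-v∩S∣ {v} = cong ∣_∣ (trans (cong (_∩ O D v) O-q≡S) (∩-comm S (O D v)))

  out-neighbour∈S : a ∈ S → D a w ≡ true → w ≢ p → w ∈ S
  out-neighbour∈S a∈S a→w w≢p = x∈without⁺ w≢p (λ { refl → asymmetric a→w (q→S a∈S) })

  module _ (Q⁺ : OutQuadrangular D) (1<∣S∣ : 1 < ∣ S ∣) where
    common-out-neighbour-of-distinct : a ∈ S → b ∈ S → a ≢ b →
                                       ∃[ w ] (w ∈ S × D a w ≡ true × D b w ≡ true)
    common-out-neighbour-of-distinct {a} {b} a∈S b∈S a≢b =
      let p∈O-a∩O-b      = x∈p∩q⁺ (arc⇒∈O D (S→p a∈S) , arc⇒∈O D (S→p b∈S))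
          w , w∈ , w≢p   = ∣p∣≢1∧x∈p⇒∃≢x (Q⁺ a b a≢b) p∈O-a∩O-b
          w∈O-a , w∈O-b  = x∈p∩q⁻ (O D a) (O D b) w∈
      in w , out-neighbour∈S a∈S (∈O⇒arc D w∈O-a) w≢p , ∈O⇒arc D w∈O-a , ∈O⇒arc D w∈O-b

    common-out-neighbour : CommonInNeighbours (rev D) S
    common-out-neighbour {a} {b} a∈S b∈S with a ≟ b
    ... | no a≢b  = common-out-neighbour-of-distinct a∈S b∈S a≢b
    ... | yes refl =
      let b′ , b′∈S , b′≢a   = 1<∣p∣⇒∃≢ 1<∣S∣ a
          w , w∈S , a→w , _ = common-out-neighbour-of-distinct a∈S b′∈S (≢-sym b′≢a)
      in w , w∈S , a→w , a→w

    minOutDeg≥2 : MinOutDeg≥ D S 2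
    minOutDeg≥2 v v∈S =
      let w , w∈S , v→w , _ = common-out-neighbour v∈S v∈S
          q≢v               = ≢-sym (proj₂ (x∈without⁻ v∈S))
      in ∣p∣≢1∧x∈p⇒1<∣p∣ (Q⁺ q v q≢v ∘ trans ∣O-q∩O-v∣≡∣O-v∩S∣) (x∈p∩q⁺ (arc⇒∈O D v→w , w∈S))

  module _ (δ⁺ : MinOutDeg≥ D S 2) (common : CommonInNeighbours (rev D) S) where
    Empty-O-p∩O-v : ¬ D v q ≡ true → Empty (O D p ∩ O D v)
    Empty-O-p∩O-v {v} ¬v→q (z , z∈) with x∈p∩q⁻ (O D p) (O D v) z∈
    ... | z∈O-p , z∈O-v with p→z⇒z≡q {z} (∈O⇒arc D z∈O-p)
    ... | refl = ¬v→q (∈O⇒arc D z∈O-v)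

    ∣O-u∩O-v∣≢1 : u ∈ S → v ∈ S → ∣ O D u ∩ O D v ∣ ≢ 1
    ∣O-u∩O-v∣≢1 u∈S v∈S =
      let w , w∈S , u→w , v→w = common u∈S v∈S
      in >⇒≢ (x∈p∧y∈p∧x≢y⇒1<∣p∣ (x∈p∩q⁺ (arc⇒∈O D (S→p u∈S) , arc⇒∈O D (S→p v∈S)))
                                  (x∈p∩q⁺ (arc⇒∈O D u→w , arc⇒∈O D v→w))
                                  (≢-sym (proj₁ (x∈without⁻ w∈S))))

    outQuadrangular : OutQuadrangular D
    outQuadrangular = symmetric-by-cases (λ u v → ∣ O D u ∩ O D v ∣ ≢ 1)
      (λ {u} {v} ≢1 → ≢1 ∘ trans (cong ∣_∣ (∩-comm (O D u) (O D v))))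
      (Empty⇒∣p∣≢1 (Empty-O-p∩O-v irreflexive))
      (λ v∈S → Empty⇒∣p∣≢1 (Empty-O-p∩O-v (asymmetric (q→S v∈S))))
      (λ {v} v∈S → >⇒≢ (subst (1 <_) (sym ∣O-q∩O-v∣≡∣O-v∩S∣) (δ⁺ v v∈S)))
      ∣O-u∩O-v∣≢1

  outQuadrangular⇔ : 1 < ∣ S ∣ → OutQuadrangular D ⇔ (MinOutDeg≥ D S 2 × CommonInNeighbours (rev D) S)
  outQuadrangular⇔ 1<∣S∣ = mk⇔
    (λ Q⁺ → minOutDeg≥2 Q⁺ 1<∣S∣ , λ {a b} → common-out-neighbour Q⁺ 1<∣S∣)
    from
    where
    from : MinOutDeg≥ D S 2 × CommonInNeighbours (rev D) S → OutQuadrangular D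
    from (δ⁺ , common) = outQuadrangular δ⁺ common

pendantArc⇒quadrangular⇔ : IsTournament D → PendantArc D x y → 1 < ∣ without x y ∣ →
  Quadrangular D ⇔ ((MinOutDeg≥ D (without x y) 2 × CommonInNeighbours (rev D) (without x y)) ×
                    (MinInDeg≥ D (without x y) 2 × CommonInNeighbours D (without x y)))
pendantArc⇒quadrangular⇔ {D = D} {x} {y} tour P 1<∣S∣ =
  ⇔-trans quadrangular⇔
    (PendantArcProperties.outQuadrangular⇔ tour P 1<∣S∣ ×-⇔
     subst (λ S → OutQuadrangular (rev D) ⇔ (MinOutDeg≥ (rev D) S 2 × CommonInNeighbours D S))
           (without-comm y x)
           (PendantArcProperties.outQuadrangular⇔ (rev-isTournament tour) (PendantArc-rev tour P)
              (subst (λ S → 1 < ∣ S ∣) (without-comm x y) 1<∣S∣)))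

module OutDegreeOne {T : Digraph n} (tour : IsTournament T) {x y : Fin n}
                    (dx : ∣ O T x ∣ ≡ 1) (xy : T x y ≡ true) where
  open Tournament tour

  x→z⇒z≡y : T x z ≡ true → z ≡ y
  x→z⇒z≡y {z} x→z with z ≟ y
  ... | yes z≡y = z≡y
  ... | no z≢y  = contradiction dx (>⇒≢ (x∈p∧y∈p∧x≢y⇒1<∣p∣ (arc⇒∈O T x→z) (arc⇒∈O T xy) z≢y))

  S→x : v ∈ without x y → T v x ≡ true
  S→x v∈S = let v≢x , v≢y = x∈without⁻ v∈S in ¬arc⇒arc (≢-sym v≢x) (v≢y ∘ x→z⇒z≡y)

  pendantArc : (∀ {v} → v ∈ without x y → T y v ≡ true) → PendantArc T x y
  pendantArc y→S = record { p→q = xy ; p→z⇒z≡q = x→z⇒z≡y ; q→S = y→S ; S→p = S→x }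

  outQuadrangular⇒y→S : OutQuadrangular T → v ∈ without x y → T y v ≡ true
  outQuadrangular⇒y→S {v} Q⁺ v∈S with T y v ≟ᵇ true
  ... | yes y→v = y→v
  ... | no ¬y→v =
    let v≢x , v≢y     = x∈without⁻ v∈S
        v→y           = ¬arc⇒arc (≢-sym v≢y) ¬y→v
        w , w∈ , w≢y  = ∣p∣≢1∧x∈p⇒∃≢x (Q⁺ x v (≢-sym v≢x)) (x∈p∩q⁺ (arc⇒∈O T xy , arc⇒∈O T v→y))
    in contradiction (x→z⇒z≡y (∈O⇒arc T (proj₁ (x∈p∩q⁻ (O T x) (O T v) w∈)))) w≢y

theorem7 : ∀ {n : ℕ} (T : Digraph n) → IsTournament T → 4 ≤ n →
    (x y : Fin n) → ∣ O T x ∣ ≡ 1 → T x y ≡ true →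
    Quadrangular T ⇔
      (O T y ≡ without x y
       × DominationNumber> T (without x y) 2
       × DominationNumber> (rev T) (without x y) 2
       × MinOutDeg≥ T (without x y) 2
       × MinInDeg≥ T (without x y) 2)
theorem7 T tour 4≤n x y dx xy = mk⇔
  (λ Q →
    let P = pendantArc (outQuadrangular⇒y→S (proj₁ (to quadrangular⇔ Q)))
        (δ⁺ , common⁺) , (δ⁻ , common⁻) = to (pendantArc⇒quadrangular⇔ tour P 1<∣S∣) Q
    in PendantArcProperties.O-q≡S tour P , γ.commonInNeighbours⇒γ>2 S-nonempty common⁻ ,
       γʳ.commonInNeighbours⇒γ>2 S-nonempty common⁺ , δ⁺ , δ⁻)
  (λ (O-y≡S , γ>2 , γʳ>2 , δ⁺ , δ⁻) →
    let P = pendantArc (λ v∈S → ∈O⇒arc T (subst (_ ∈_) (sym O-y≡S) v∈S))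
    in from (pendantArc⇒quadrangular⇔ tour P 1<∣S∣)
         ((δ⁺ , γʳ.γ>2⇒commonInNeighbours γʳ>2) , (δ⁻ , γ.γ>2⇒commonInNeighbours γ>2)))
  where
  open OutDegreeOne tour dx xy
  open Equivalence
  module γ  = Domination tour
  module γʳ = Domination (rev-isTournament tour)

  1<∣S∣ : 1 < ∣ without x y ∣
  1<∣S∣ = ≤-trans (∸-monoˡ-≤ 2 4≤n) (n∸2≤∣without∣ x y)

  S-nonempty : Nonempty (without x y)
  S-nonempty = let v , v∈S , _ = 1<∣p∣⇒∃≢ 1<∣S∣ x in v , v∈S
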